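{- For each $m<\omega$ there is an $M<\omega$ such that whenever $\mathscr Y$ is a finite family of ordered pairs $(X,Y)$ with $X\subseteq\mathbb B$ linearly independent and $Y$ suitable for $X$, and a $(\mathscr Y,M)$-adequate set $A\subseteq\mathbb B$ is partitioned into two cells, one of the cells is $(\mathscr Y,m)$-adequate.
   Context: $\mathbb B=[\omega]^{<\omega}$ with symmetric difference as group operation, a vector space over $\mathbb F_2$. For $X\subseteq\mathbb B$, $\mathrm{FS}(X)$ is the set of sums of finite nonempty subsets of $X$; for an $m$-sequence $\vec a$, $\mathrm{FS}(\vec a)=\{\sum_{j\in s}a_j: \varnothing\neq s\subseteq m\}$. For linearly independent $X$ and $y\in\mathrm{FS}(X)$, $X\text{ - }\mathrm{supp}(y)$ is the unique finite $F\subseteq X$ with $y=\sum_{x\in F}x$; $X\text{ - }\mathrm{supp}(\varnothing)=\varnothing$; for $W\subseteq\mathrm{FS}(X)$, $X\text{ - }\mathrm{supp}(W)=\bigcup_{w\in W}X\text{ - }\mathrm{supp}(w)$. For linearly independent $X$, a set $Y\subseteq\mathrm{FS}(X)$ is suitable for $X$ if: (i) for each $m<\omega$ there is an $m$-sequence $\langle y_i:i<m\rangle$ of elements of $Y$ (an $m$-witness for suitability) such that $X\text{ - }\mathrm{supp}(y_i)\cap X\text{ - }\mathrm{supp}(y_j)\neq\varnothing$ whenever $i<j<m$; (ii) whenever $y,y'\in Y$ (possibly equal) satisfy $X\text{ - }\mathrm{supp}(y)\cap X\text{ - }\mathrm{supp}(y')\neq\varnothing$, the set $[X\text{ - }\mathrm{supp}(y)\cap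 X\text{ - }\mathrm{supp}(y')]\setminus X\text{ - }\mathrm{supp}(Y\setminus\{y,y'\})$ is nonempty. For $A\subseteq\mathbb B$, a finite family $\mathscr Y=\{(X_i,Y_i):i<n\}$ of such pairs and $m<\omega$: $A$ is $(\mathscr Y,m)$-adequate if there is an $m$-sequence $\langle a_j:j<m\rangle$ such that for each $i<n$: (a) $\mathrm{FS}(\vec a)\subseteq A\cap\mathrm{FS}(Y_i)$; (b) there is an $m$-witness $\langle y_j:j<m\rangle$ for the suitability of $Y_i$ (for $X_i$) with $y_j\in Y_i\text{ - }\mathrm{supp}(a_j)$ and $y_j\notin Y_i\text{ - }\mathrm{supp}(a_k)$ for distinct $j,k<m$. -}

module Defs where

open import Data.Nat using (ℕ; zero; suc; _+_; _∸_; _<ᵇ_)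
open import Data.Bool using (Bool; true; false; if_then_else_)
open import Data.List using (List; []; _∷_; foldr)
open import Data.List.Membership.Propositional using (_∈_)
open import Data.List.Relation.Unary.All using (All)
open import Data.List.Relation.Unary.Unique.Propositional using (Unique)
open import Data.Vec using (Vec; []; _∷_)
open import Data.Fin using (Fin; zero; suc) renaming (_<_ to _<ᶠ_)
open import Data.Fin.Subset using (Subset; Nonempty) renaming (_∈_ to _∈ˢ_)
open import Data.Product using (Σ; _×_; ∃; ∃-syntax)
open import Data.Sum using (_⊎_)
open import Relation.Nullary using (¬_)
open import Relation.Binary.PropositionalEquality using (_≡_; _≢_)

-- An element of 𝔹 (a finite subset of ℕ) is coded canonically by its
-- list of gaps: [g₀, g₁, …, g_k] codes the set
--   { g₀ , g₀+1+g₁ , g₀+1+g₁+1+g₂ , … }.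
-- This is a bijection between List ℕ and finite subsets of ℕ, so
-- propositional equality on codes is equality of finite sets.

𝔹 : Set
𝔹 = List ℕ

elemsFrom : ℕ → 𝔹 → List ℕ
elemsFrom base []       = []
elemsFrom base (g ∷ gs) = (base + g) ∷ elemsFrom (suc (base + g)) gs

elems : 𝔹 → List ℕ
elems = elemsFrom 0

-- code of a strictly increasing list (inverse of elems)
codeFrom : ℕ → List ℕ → 𝔹
codeFrom base []       = []
codeFrom base (a ∷ as) = (a ∸ base) ∷ codeFrom (suc a) as

code : List ℕ → 𝔹
code = codeFrom 0

symdiff : List ℕ → List ℕ → List ℕ
symdiff [] ys = ys
symdiff (x ∷ xs) [] = x ∷ xs
symdiff (x ∷ xs) (y ∷ ys) =
  if x <ᵇ y then x ∷ symdiff xs (y ∷ ys)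
  else if y <ᵇ x then y ∷ symdiff (x ∷ xs) ys
  else symdiff xs ys

infixl 6 _⊕_
_⊕_ : 𝔹 → 𝔹 → 𝔹
x ⊕ y = code (symdiff (elems x) (elems y))

𝟘 : 𝔹
𝟘 = []

Σᴮ : List 𝔹 → 𝔹
Σᴮ = foldr _⊕_ 𝟘

sumSub : ∀ {m} → (Fin m → 𝔹) → Subset m → 𝔹
sumSub {zero}  a []           = 𝟘
sumSub {suc m} a (true  ∷ s)  = a zero ⊕ sumSub (λ j → a (suc j)) s
sumSub {suc m} a (false ∷ s)  = sumSub (λ j → a (suc j)) s

SetB : Set₁
SetB = 𝔹 → Set

FinSubsetOf : SetB → List 𝔹 → Set
FinSubsetOf X F = Unique F × All X F

LinIndep : SetB → Set
LinIndep X = ∀ (F : List 𝔹) → FinSubsetOf X F → Σᴮ F ≡ 𝟘 → F ≡ []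

FS : SetB → SetB
FS X y = ∃[ F ] (FinSubsetOf X F × F ≢ [] × Σᴮ F ≡ y)

-- F is the X-support of y: the (for linearly independent X unique)
-- finite F ⊆ X with y = Σ_{x ∈ F} x.  (For y = ∅ this is F = ∅.)
IsSupp : SetB → 𝔹 → List 𝔹 → Set
IsSupp X y F = FinSubsetOf X F × Σᴮ F ≡ y

InSupp : SetB → 𝔹 → 𝔹 → Set
InSupp X y x = ∃[ F ] (IsSupp X y F × x ∈ F)

SuppMeet : SetB → 𝔹 → 𝔹 → Set
SuppMeet X y y' = ∃[ x ] (InSupp X y x × InSupp X y' x)

IsWitness : SetB → SetB → (m : ℕ) → (Fin m → 𝔹) → Set
IsWitness X Y m y =
  (∀ i → Y (y i)) × (∀ i j → i <ᶠ j → SuppMeet X (y i) (y j))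

Suitable : SetB → SetB → Set
Suitable X Y =
  (∀ y → Y y → FS X y) ×
  (∀ (m : ℕ) → ∃[ w ] IsWitness X Y m w) ×
  (∀ y y' → Y y → Y y' → SuppMeet X y y' →
     ∃[ x ] (InSupp X y x × InSupp X y' x ×
             (∀ w → Y w → w ≢ y → w ≢ y' → ¬ InSupp X w x)))

-- A is (𝒴, m)-adequate, where 𝒴 = {(Xs i, Ys i) : i < n}
Adequate : (n : ℕ) → (Xs Ys : Fin n → SetB) → SetB → ℕ → Set
Adequate n Xs Ys A m =
  ∃[ a ] ∀ (i : Fin n) →
    (∀ (s : Subset m) → Nonempty s → A (sumSub a s) × FS (Ys i) (sumSub a s)) ×
    (∃[ y ] (IsWitness (Xs i) (Ys i) m y ×
             (∀ j → InSupp (Ys i) (a j) (y j)) ×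
             (∀ j k → j ≢ k → ¬ InSupp (Ys i) (a k) (y j))))

-- Colour each nonempty D ⊆ M by the cell containing Σ_{s ∈ D} a_s, where ⟨a_s : s < M⟩ witnesses the
-- adequacy of A. Folkman's finite unions theorem, derived from the Hales–Jewett theorem over {0, 1}
-- through parameter words, yields disjoint nonempty blocks D_0, …, D_{m-1} all of whose nonempty unions
-- lie in one cell, so the block sums b_j = Σ_{s ∈ D_j} a_s satisfy (a) for that cell. For (b) take
-- y_{t_j} with t_j ∈ D_j. Suitability makes Y linearly independent, so y_{t_j} lies in the Y-support
-- of b_k iff it lies in the Y-supports of an odd number of the a_s with s ∈ D_k, which happens iff j = k.

module Submission where

open import Defs
open import Data.Nat using (ℕ)
open import Data.Fin using (Fin)
open import Data.Product using (Σ; _×_; ∃; ∃-syntax)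
open import Data.Sum using (_⊎_)
open import Relation.Nullary using (¬_)

open import Relation.Binary.Definitions using (DecidableEquality)
open import Data.Bool using (Bool; true; false; _xor_)
open import Data.Bool.Properties using (not-involutive; not-injective; xor-annihilates-not)
open import Relation.Binary.PropositionalEquality using (_≡_; refl)

xor-cancelˡ : ∀ x y → x xor (x xor y) ≡ y
xor-cancelˡ false y = refl
xor-cancelˡ true  y = not-involutive y

xor-swap : ∀ x y z → x xor (y xor z) ≡ y xor (x xor z)
xor-swap false y     z = refl
xor-swap true  false z = refl
xor-swap true  true  z = refl

xor-cancel-common : ∀ x y z → (x xor y) xor (x xor z) ≡ y xor z
xor-cancel-common false y z = refl
xor-cancel-common true  y z = xor-annihilates-not y z

xor-injective : ∀ x {y z} → x xor y ≡ x xor z → y ≡ z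
xor-injective false eq = eq
xor-injective true  eq = not-injective eq

module Parity {a} {A : Set a} (_≟_ : DecidableEquality A) where

  open import Data.Bool.Properties using (xor-assoc)
  open import Data.List using (List; []; _∷_; _++_)
  open import Data.List.Membership.Propositional using (_∈_; _∉_)
  open import Data.List.Relation.Unary.Any using (here; there)
  open import Data.List.Relation.Unary.All using (All; []; _∷_)
  open import Data.List.Relation.Unary.All.Properties using (¬Any⇒All¬; All¬⇒¬Any)
  open import Data.List.Relation.Unary.AllPairs using ([]; _∷_)
  open import Data.List.Relation.Unary.Unique.Propositional using (Unique)
  open import Data.Sum using (inj₁; inj₂)
  import Data.Sum
  open import Function using (_∘_)
  open import Relation.Nullary using (does; yes; no)
  open import Relation.Nullary.Decidable using (dec-true; dec-false)
  open import Relation.Binary.PropositionalEquality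

  parity : A → List A → Bool
  parity z []      = false
  parity z (x ∷ l) = does (z ≟ x) xor parity z l

  parity-++ : ∀ z xs ys → parity z (xs ++ ys) ≡ parity z xs xor parity z ys
  parity-++ z []       ys = refl
  parity-++ z (x ∷ xs) ys =
    trans (cong (does (z ≟ x) xor_) (parity-++ z xs ys)) (sym (xor-assoc (does (z ≟ x)) _ _))

  parity-∉ : ∀ {z} l → z ∉ l → parity z l ≡ false
  parity-∉         []      _   = refl
  parity-∉ {z} (x ∷ l) z∉ =
    cong₂ _xor_ (dec-false (z ≟ x) (z∉ ∘ here)) (parity-∉ l (z∉ ∘ there))

  parity-∈ : ∀ {z} l → Unique l → z ∈ l → parity z l ≡ true
  parity-∈ (x ∷ l) (x∉l ∷ _) (here refl) =
    cong₂ _xor_ (dec-true (x ≟ x) refl) (parity-∉ l (All¬⇒¬Any x∉l))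
  parity-∈ {z} (x ∷ l) (x∉l ∷ u) (there z∈l) =
    cong₂ _xor_ (dec-false (z ≟ x) λ { refl → All¬⇒¬Any x∉l z∈l }) (parity-∈ l u z∈l)

  parity-true⇒∈ : ∀ {z} l → parity z l ≡ true → z ∈ l
  parity-true⇒∈ {z} (x ∷ l) odd with z ≟ x
  ... | yes z≡x = here z≡x
  ... | no  _   = there (parity-true⇒∈ l odd)

  toggle : A → List A → List A
  toggle x []      = x ∷ []
  toggle x (y ∷ l) with x ≟ y
  ... | yes _ = l
  ... | no  _ = y ∷ toggle x l

  parity-toggle : ∀ z x l → parity z (toggle x l) ≡ does (z ≟ x) xor parity z l
  parity-toggle z x []      = refl
  parity-toggle z x (y ∷ l) with x ≟ y
  ... | yes refl = sym (xor-cancelˡ (does (z ≟ x)) (parity z l))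
  ... | no  _    = trans (cong (does (z ≟ y) xor_) (parity-toggle z x l)) (xor-swap (does (z ≟ y)) (does (z ≟ x)) _)

  ∈-toggle : ∀ {z} x l → z ∈ toggle x l → z ≡ x ⊎ z ∈ l
  ∈-toggle x []      (here z≡x) = inj₁ z≡x
  ∈-toggle x (y ∷ l) z∈ with x ≟ y | z∈
  ... | yes _ | z∈l         = inj₂ (there z∈l)
  ... | no  _ | here z≡y    = inj₂ (here z≡y)
  ... | no  _ | there z∈tog = Data.Sum.map₂ there (∈-toggle x l z∈tog)

  toggle-unique : ∀ x l → Unique l → Unique (toggle x l)
  toggle-unique x []      _            = [] ∷ []
  toggle-unique x (y ∷ l) (y∉l ∷ u) with x ≟ y
  ... | yes _   = u
  ... | no  x≢y = ¬Any⇒All¬ (toggle x l) y∉ ∷ toggle-unique x l u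
    where
    y∉ : y ∉ toggle x l
    y∉ y∈ with ∈-toggle x l y∈
    ... | inj₁ y≡x = x≢y (sym y≡x)
    ... | inj₂ y∈l = All¬⇒¬Any y∉l y∈l

  toggle-All : ∀ {p} {P : A → Set p} {x} l → P x → All P l → All P (toggle x l)
  toggle-All         []      px _          = px ∷ []
  toggle-All {x = x} (y ∷ l) px (py ∷ pl) with x ≟ y
  ... | yes _ = pl
  ... | no  _ = py ∷ toggle-All l px pl

  cancelPairs : List A → List A
  cancelPairs []      = []
  cancelPairs (x ∷ l) = toggle x (cancelPairs l)

  parity-cancelPairs : ∀ z l → parity z (cancelPairs l) ≡ parity z l
  parity-cancelPairs z []      = refl
  parity-cancelPairs z (x ∷ l) =
    trans (parity-toggle z x (cancelPairs l)) (cong (does (z ≟ x) xor_) (parity-cancelPairs z l))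

  cancelPairs-unique : ∀ l → Unique (cancelPairs l)
  cancelPairs-unique []      = []
  cancelPairs-unique (x ∷ l) = toggle-unique x (cancelPairs l) (cancelPairs-unique l)

  cancelPairs-All : ∀ {p} {P : A → Set p} {l} → All P l → All P (cancelPairs l)
  cancelPairs-All []         = []
  cancelPairs-All {l = x ∷ l} (px ∷ pl) = toggle-All (cancelPairs l) px (cancelPairs-All pl)

module BooleanGroup where

  open import Data.Nat using (suc; _+_; _<ᵇ_; _≤_; _<_; _≟_)
  open import Data.Nat.Properties
    using (≤-refl; ≤-trans; ≤-antisym; <-≤-trans; ≮⇒≥; n≤1+n; n<1+n; m<n⇒m<1+n; <⇒≢;
           m≤m+n; m+n∸m≡n; m+[n∸m]≡n; <ᵇ-reflects-<; <-cmp)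
  open import Data.Bool.Properties using (xor-assoc; xor-comm; xor-same; xor-identityʳ)
  open import Data.List using (List; []; _∷_)
  open import Data.Unit using (⊤)
  open import Data.Product using (_,_)
  open import Relation.Nullary using (does; contradiction)
  open import Relation.Nullary.Reflects using (ofʸ; ofⁿ)
  open import Relation.Nullary.Decidable using (dec-true; dec-false)
  open import Relation.Binary using (tri<; tri≈; tri>)
  open import Relation.Binary.PropositionalEquality
  open ≡-Reasoning
  open Parity _≟_

  SortedFrom : ℕ → List ℕ → Set
  SortedFrom b []      = ⊤
  SortedFrom b (a ∷ l) = b ≤ a × SortedFrom (suc a) l

  SortedFrom-weaken : ∀ {b b'} l → b ≤ b' → SortedFrom b' l → SortedFrom b l
  SortedFrom-weaken []      _    _               = _
  SortedFrom-weaken (a ∷ l) b≤b' (b'≤a , sorted) = ≤-trans b≤b' b'≤a , sorted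

  elemsFrom-sorted : ∀ b x → SortedFrom b (elemsFrom b x)
  elemsFrom-sorted b []       = _
  elemsFrom-sorted b (g ∷ gs) = m≤m+n b g , elemsFrom-sorted (suc (b + g)) gs

  codeFrom-elemsFrom : ∀ b x → codeFrom b (elemsFrom b x) ≡ x
  codeFrom-elemsFrom b []       = refl
  codeFrom-elemsFrom b (g ∷ gs) = cong₂ _∷_ (m+n∸m≡n b g) (codeFrom-elemsFrom (suc (b + g)) gs)

  elemsFrom-codeFrom : ∀ b l → SortedFrom b l → elemsFrom b (codeFrom b l) ≡ l
  elemsFrom-codeFrom b []      _              = refl
  elemsFrom-codeFrom b (a ∷ l) (b≤a , sorted) rewrite m+[n∸m]≡n b≤a =
    cong (a ∷_) (elemsFrom-codeFrom (suc a) l sorted)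

  symdiff-sorted : ∀ {b} xs ys → SortedFrom b xs → SortedFrom b ys → SortedFrom b (symdiff xs ys)
  symdiff-sorted []       ys  _          sys = sys
  symdiff-sorted (x ∷ xs) ys₀ (b≤x₀ , sxs) = merge ys₀ b≤x₀
    where
    merge : ∀ {b} ys → b ≤ x → SortedFrom b ys → SortedFrom b (symdiff (x ∷ xs) ys)
    merge []       b≤x _           = b≤x , sxs
    merge (y ∷ ys) b≤x (b≤y , sys) with x <ᵇ y | <ᵇ-reflects-< x y
    ... | true  | ofʸ x<y = b≤x , symdiff-sorted xs (y ∷ ys) sxs (x<y , sys)
    ... | false | ofⁿ _ with y <ᵇ x | <ᵇ-reflects-< y x
    ... | true  | ofʸ y<x = b≤y , merge ys y<x sys
    ... | false | ofⁿ _   = symdiff-sorted xs ys (SortedFrom-weaken xs (≤-trans b≤x (n≤1+n x)) sxs)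
                                               (SortedFrom-weaken ys (≤-trans b≤y (n≤1+n y)) sys)

  parity-symdiff : ∀ n xs ys → parity n (symdiff xs ys) ≡ parity n xs xor parity n ys
  parity-symdiff n []       ys₀ = refl
  parity-symdiff n (x ∷ xs) ys₀ = merge ys₀
    where
    merge : ∀ ys → parity n (symdiff (x ∷ xs) ys) ≡ parity n (x ∷ xs) xor parity n ys
    merge []       = sym (xor-identityʳ _)
    merge (y ∷ ys) with x <ᵇ y | <ᵇ-reflects-< x y
    ... | true  | _ =
      trans (cong (does (n ≟ x) xor_) (parity-symdiff n xs (y ∷ ys))) (sym (xor-assoc (does (n ≟ x)) _ _))
    ... | false | ofⁿ x≮y with y <ᵇ x | <ᵇ-reflects-< y x
    ... | true  | _ =
      trans (cong (does (n ≟ y) xor_) (merge ys)) (xor-swap (does (n ≟ y)) (does (n ≟ x) xor parity n xs) _)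
    ... | false | ofⁿ y≮x with ≤-antisym (≮⇒≥ y≮x) (≮⇒≥ x≮y)
    ... | refl = trans (parity-symdiff n xs ys) (sym (xor-cancel-common (does (n ≟ x)) _ _))

  parity-below : ∀ {n c} l → SortedFrom c l → n < c → parity n l ≡ false
  parity-below         []      _              _   = refl
  parity-below {n} (a ∷ l) (c≤a , sorted) n<c =
    cong₂ _xor_ (dec-false (n ≟ a) (<⇒≢ n<a)) (parity-below l sorted (m<n⇒m<1+n n<a))
    where n<a = <-≤-trans n<c c≤a

  parity-head : ∀ {a} l → SortedFrom (suc a) l → parity a (a ∷ l) ≡ true
  parity-head {a} l sorted = cong₂ _xor_ (dec-true (a ≟ a) refl) (parity-below l sorted (n<1+n a))

  sorted-parity-injective : ∀ {b b'} l l' → SortedFrom b l → SortedFrom b' l' →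
                            (∀ n → parity n l ≡ parity n l') → l ≡ l'
  sorted-parity-injective []      []        _ _ _ = refl
  sorted-parity-injective []      (a' ∷ l') _ (_ , s') same =
    contradiction (trans (same a') (parity-head l' s')) λ ()
  sorted-parity-injective (a ∷ l) []        (_ , s) _ same =
    contradiction (trans (sym (same a)) (parity-head l s)) λ ()
  sorted-parity-injective (a ∷ l) (a' ∷ l') (_ , s) (_ , s') same with <-cmp a a'
  ... | tri< a<a' _ _ =
    contradiction (trans (sym (parity-head l s)) (trans (same a) (parity-below (a' ∷ l') (≤-refl , s') a<a'))) λ ()
  ... | tri> _ _ a'<a =
    contradiction (trans (sym (parity-head l' s')) (trans (sym (same a')) (parity-below (a ∷ l) (≤-refl , s) a'<a))) λ ()
  ... | tri≈ _ refl _ =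
    cong (a ∷_) (sorted-parity-injective l l' s s' λ n → xor-injective (does (n ≟ a)) (same n))

  occurs : ℕ → 𝔹 → Bool
  occurs n x = parity n (elems x)

  occurs-⊕ : ∀ n x y → occurs n (x ⊕ y) ≡ occurs n x xor occurs n y
  occurs-⊕ n x y = begin
    parity n (elems (code (symdiff (elems x) (elems y))))
      ≡⟨ cong (parity n) (elemsFrom-codeFrom 0 _ symdiff-sorted₀) ⟩
    parity n (symdiff (elems x) (elems y))
      ≡⟨ parity-symdiff n (elems x) (elems y) ⟩
    occurs n x xor occurs n y ∎
    where
    symdiff-sorted₀ = symdiff-sorted (elems x) (elems y) (elemsFrom-sorted 0 x) (elemsFrom-sorted 0 y)

  occurs-injective : ∀ x y → (∀ n → occurs n x ≡ occurs n y) → x ≡ y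
  occurs-injective x y same = begin
    x                ≡⟨ codeFrom-elemsFrom 0 x ⟨
    code (elems x)   ≡⟨ cong code (sorted-parity-injective (elems x) (elems y)
                                     (elemsFrom-sorted 0 x) (elemsFrom-sorted 0 y) same) ⟩
    code (elems y)   ≡⟨ codeFrom-elemsFrom 0 y ⟩
    y                ∎

  ⊕-comm : ∀ x y → x ⊕ y ≡ y ⊕ x
  ⊕-comm x y = occurs-injective _ _ λ n → begin
    occurs n (x ⊕ y)           ≡⟨ occurs-⊕ n x y ⟩
    occurs n x xor occurs n y  ≡⟨ xor-comm (occurs n x) _ ⟩
    occurs n y xor occurs n x  ≡⟨ occurs-⊕ n y x ⟨
    occurs n (y ⊕ x)           ∎

  ⊕-assoc : ∀ x y z → (x ⊕ y) ⊕ z ≡ x ⊕ (y ⊕ z)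
  ⊕-assoc x y z = occurs-injective _ _ λ n → begin
    occurs n ((x ⊕ y) ⊕ z)                         ≡⟨ occurs-⊕ n (x ⊕ y) z ⟩
    occurs n (x ⊕ y) xor occurs n z                ≡⟨ cong (_xor occurs n z) (occurs-⊕ n x y) ⟩
    (occurs n x xor occurs n y) xor occurs n z     ≡⟨ xor-assoc (occurs n x) _ _ ⟩
    occurs n x xor (occurs n y xor occurs n z)     ≡⟨ cong (occurs n x xor_) (occurs-⊕ n y z) ⟨
    occurs n x xor occurs n (y ⊕ z)                ≡⟨ occurs-⊕ n x (y ⊕ z) ⟨
    occurs n (x ⊕ (y ⊕ z))                         ∎

  ⊕-identityˡ : ∀ x → 𝟘 ⊕ x ≡ x
  ⊕-identityˡ x = occurs-injective _ _ λ n → occurs-⊕ n 𝟘 x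

  ⊕-self : ∀ x → x ⊕ x ≡ 𝟘
  ⊕-self x = occurs-injective _ _ λ n → trans (occurs-⊕ n x x) (xor-same (occurs n x))

  ⊕-cancelˡ : ∀ x y → x ⊕ (x ⊕ y) ≡ y
  ⊕-cancelˡ x y = begin
    x ⊕ (x ⊕ y)  ≡⟨ ⊕-assoc x x y ⟨
    (x ⊕ x) ⊕ y  ≡⟨ cong (_⊕ y) (⊕-self x) ⟩
    𝟘 ⊕ y        ≡⟨ ⊕-identityˡ y ⟩
    y            ∎

  ⊕-cancel-common : ∀ x y z → (x ⊕ y) ⊕ (x ⊕ z) ≡ y ⊕ z
  ⊕-cancel-common x y z = occurs-injective _ _ λ n → begin
    occurs n ((x ⊕ y) ⊕ (x ⊕ z))                                     ≡⟨ occurs-⊕ n (x ⊕ y) (x ⊕ z) ⟩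
    occurs n (x ⊕ y) xor occurs n (x ⊕ z)                            ≡⟨ cong₂ _xor_ (occurs-⊕ n x y) (occurs-⊕ n x z) ⟩
    (occurs n x xor occurs n y) xor (occurs n x xor occurs n z)      ≡⟨ xor-cancel-common (occurs n x) _ _ ⟩
    occurs n y xor occurs n z                                        ≡⟨ occurs-⊕ n y z ⟨
    occurs n (y ⊕ z)                                                 ∎

  ⊕-swap : ∀ x y z → x ⊕ (y ⊕ z) ≡ y ⊕ (x ⊕ z)
  ⊕-swap x y z = begin
    x ⊕ (y ⊕ z)  ≡⟨ ⊕-assoc x y z ⟨
    (x ⊕ y) ⊕ z  ≡⟨ cong (_⊕ z) (⊕-comm x y) ⟩
    (y ⊕ x) ⊕ z  ≡⟨ ⊕-assoc y x z ⟩
    y ⊕ (x ⊕ z)  ∎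

module ParameterWords where

  open import Data.Nat using (suc)
  open import Data.Vec using (Vec; _∷_; map; lookup)
  open import Data.Vec.Properties using (map-∘; map-cong; lookup-map; lookup⇒[]=; []=⇒lookup)
  open import Data.Fin using (zero; suc)
  open import Data.Fin.Subset using (Subset; Nonempty) renaming (⊥ to ∅)
  open import Data.Product using (_,_)
  open import Relation.Binary.PropositionalEquality

  data Letter (K : ℕ) : Set where
    𝟎 𝟏 : Letter K
    var : Fin K → Letter K

  Word : ℕ → ℕ → Set
  Word N K = Vec (Letter K) N

  value : ∀ {K} → Subset K → Letter K → Bool
  value S 𝟎       = false
  value S 𝟏       = true
  value S (var t) = lookup S t

  inst : ∀ {N K} → Word N K → Subset K → Subset N
  inst w S = map (value S) w

  EveryVarOccurs : ∀ {N K} → Word N K → Set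
  EveryVarOccurs {N} {K} w = ∀ (t : Fin K) → ∃[ p ] lookup w p ≡ var t

  OneFree : ∀ {N K} → Word N K → Set
  OneFree w = ∀ p → lookup w p ≢ 𝟏

  ConstantOn : ∀ {N K c} → (Subset N → Vec Bool c) → Word N K → Set
  ConstantOn κ w = ∀ S → κ (inst w S) ≡ κ (inst w ∅)

  rename : ∀ {K L} → (Fin K → Fin L) → Letter K → Letter L
  rename f 𝟎       = 𝟎
  rename f 𝟏       = 𝟏
  rename f (var t) = var (f t)

  inst-rename : ∀ {N K L} (f : Fin K → Fin L) (w : Word N K) {S S'} →
                (∀ t → lookup S (f t) ≡ lookup S' t) → inst (map (rename f) w) S ≡ inst w S'
  inst-rename f w {S} {S'} agree = trans (sym (map-∘ (value S) (rename f) w)) (map-cong value-rename w)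
    where
    value-rename : ∀ l → value S (rename f l) ≡ value S' l
    value-rename 𝟎       = refl
    value-rename 𝟏       = refl
    value-rename (var t) = agree t

  substitute : ∀ {K L} → Word K L → Letter K → Letter L
  substitute v 𝟎       = 𝟎
  substitute v 𝟏       = 𝟏
  substitute v (var t) = lookup v t

  compose : ∀ {N K L} → Word N K → Word K L → Word N L
  compose w v = map (substitute v) w

  inst-compose : ∀ {N K L} (w : Word N K) (v : Word K L) S → inst (compose w v) S ≡ inst w (inst v S)
  inst-compose w v S = trans (sym (map-∘ (value S) (substitute v) w)) (map-cong value-substitute w)
    where
    value-substitute : ∀ l → value S (substitute v l) ≡ value (inst v S) l
    value-substitute 𝟎       = refl
    value-substitute 𝟏       = refl
    value-substitute (var t) = sym (lookup-map t (value S) v)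

  compose-everyVarOccurs : ∀ {N K L} (w : Word N K) (v : Word K L) →
                           EveryVarOccurs w → EveryVarOccurs v → EveryVarOccurs (compose w v)
  compose-everyVarOccurs w v occw occv t with occv t
  ... | p , vp≡t with occw p
  ... | q , wq≡p = q , trans (lookup-map q (substitute v) w) (trans (cong (substitute v) wq≡p) vp≡t)

  compose-oneFree : ∀ {N K L} (w : Word N K) (v : Word K L) → OneFree w → OneFree v → OneFree (compose w v)
  compose-oneFree w v freew freev p eq =
    substitute-oneFree (lookup w p) (freew p) (trans (sym (lookup-map p (substitute v) w)) eq)
    where
    substitute-oneFree : ∀ l → l ≢ 𝟏 → substitute v l ≢ 𝟏
    substitute-oneFree 𝟎       _     ()
    substitute-oneFree 𝟏       l≢𝟏 _ = l≢𝟏 refl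
    substitute-oneFree (var t) _     = freev t

  consVar : ∀ {N K} → Word N K → Word (suc N) (suc K)
  consVar v = var zero ∷ map (rename suc) v

  inst-consVar : ∀ {N K} (v : Word N K) s S → inst (consVar v) (s ∷ S) ≡ s ∷ inst v S
  inst-consVar v s S = cong (s ∷_) (inst-rename suc v λ _ → refl)

  consVar-everyVarOccurs : ∀ {N K} (v : Word N K) → EveryVarOccurs v → EveryVarOccurs (consVar v)
  consVar-everyVarOccurs v occ zero = zero , refl
  consVar-everyVarOccurs v occ (suc t) with occ t
  ... | p , vp≡t = suc p , trans (lookup-map p (rename suc) v) (cong (rename suc) vp≡t)

  rename-≢𝟏 : ∀ {K L} (f : Fin K → Fin L) l → l ≢ 𝟏 → rename f l ≢ 𝟏
  rename-≢𝟏 f 𝟎       _   ()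
  rename-≢𝟏 f 𝟏       l≢𝟏 _ = l≢𝟏 refl
  rename-≢𝟏 f (var t) _   ()

  consVar-oneFree : ∀ {N K} (v : Word N K) → OneFree v → OneFree (consVar v)
  consVar-oneFree v free zero    ()
  consVar-oneFree v free (suc p) eq =
    rename-≢𝟏 suc (lookup v p) (free p) (trans (sym (lookup-map p (rename suc) v)) eq)

  absorbOne : ∀ {K} → Letter (suc K) → Letter (suc K)
  absorbOne 𝟏 = var zero
  absorbOne l = l

  dropVar₀ : ∀ {K} → Letter (suc K) → Letter K
  dropVar₀ 𝟎             = 𝟎
  dropVar₀ 𝟏             = 𝟏
  dropVar₀ (var zero)    = 𝟎
  dropVar₀ (var (suc t)) = var t

  inst-absorbOne : ∀ {N K} (w : Word N (suc K)) S → inst (map absorbOne w) (true ∷ S) ≡ inst w (true ∷ S)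
  inst-absorbOne w S = trans (sym (map-∘ (value (true ∷ S)) absorbOne w)) (map-cong value-absorbOne w)
    where
    value-absorbOne : ∀ l → value (true ∷ S) (absorbOne l) ≡ value (true ∷ S) l
    value-absorbOne 𝟎       = refl
    value-absorbOne 𝟏       = refl
    value-absorbOne (var t) = refl

  inst-false∷ : ∀ {N K} (w : Word N (suc K)) S → inst w (false ∷ S) ≡ inst (map dropVar₀ w) S
  inst-false∷ w S = trans (map-cong value-dropVar₀ w) (map-∘ (value S) dropVar₀ w)
    where
    value-dropVar₀ : ∀ l → value (false ∷ S) l ≡ value S (dropVar₀ l)
    value-dropVar₀ 𝟎             = refl
    value-dropVar₀ 𝟏             = refl
    value-dropVar₀ (var zero)    = refl
    value-dropVar₀ (var (suc t)) = refl

  absorbOne-everyVarOccurs : ∀ {N K} (w : Word N (suc K)) → EveryVarOccurs w → EveryVarOccurs (map absorbOne w)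
  absorbOne-everyVarOccurs w occ t with occ t
  ... | p , wp≡var = p , trans (lookup-map p absorbOne w) (cong absorbOne wp≡var)

  absorbOne-oneFree : ∀ {N K} (w : Word N (suc K)) → OneFree (map absorbOne w)
  absorbOne-oneFree w p eq = absorbOne-≢𝟏 (lookup w p) (trans (sym (lookup-map p absorbOne w)) eq)
    where
    absorbOne-≢𝟏 : ∀ l → absorbOne l ≢ 𝟏
    absorbOne-≢𝟏 𝟎       ()
    absorbOne-≢𝟏 𝟏       ()
    absorbOne-≢𝟏 (var t) ()

  inst-nonempty : ∀ {N K} (w : Word N K) → EveryVarOccurs w → ∀ S → Nonempty S → Nonempty (inst w S)
  inst-nonempty w occ S (t , t∈S) with occ t
  ... | p , wp≡var = p , lookup⇒[]= p (inst w S)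
    (trans (lookup-map p (value S) w) (trans (cong (value S) wp≡var) ([]=⇒lookup t∈S)))

module HalesJewett where

  open import Data.Nat using (zero; suc; _+_; _*_; _^_; _<_; _<ᵇ_)
  open import Data.Nat.Properties using (≤-refl; <-trans; <-≤-trans; <-irrefl; ≤-pred; <ᵇ-reflects-<)
  open import Relation.Nullary.Reflects using (ofʸ; ofⁿ)
  open import Data.Vec using (Vec; []; _∷_; map; _++_; lookup; tabulate; concat)
  open import Data.Vec.Properties
    using (map-++; lookup-map; ++-injective; lookup∘tabulate; tabulate-∘; tabulate-cong; lookup-++ˡ; lookup-++ʳ)
  open import Data.Vec.Membership.Propositional using (_∈_)
  open import Data.Vec.Membership.Propositional.Properties using (∈-map⁺; ∈-++⁺ˡ; ∈-++⁺ʳ)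
  open import Data.Vec.Relation.Unary.Any using (here; there; index)
  open import Data.Vec.Relation.Unary.Any.Properties using (lookup-index)
  open import Data.Fin using (zero; suc; toℕ; fromℕ<; _↑ˡ_; _↑ʳ_) renaming (_<_ to _<ᶠ_)
  open import Data.Fin.Properties using (pigeonhole; toℕ-fromℕ<; toℕ<n)
  open import Data.Fin.Subset using (Subset) renaming (⊥ to ∅)
  open import Data.Product using (_,_; proj₁; proj₂)
  open import Relation.Nullary using (contradiction)
  open import Relation.Binary.PropositionalEquality
  open import Function using (_∘_)
  open ≡-Reasoning
  open ParameterWords

  -- the trailing ++ [] matches 2 ^ suc q = 2 ^ q + (2 ^ q + 0)
  allSubsets : ∀ q → Vec (Subset q) (2 ^ q)
  allSubsets zero    = [] ∷ []
  allSubsets (suc q) = map (true ∷_) (allSubsets q) ++ (map (false ∷_) (allSubsets q) ++ [])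

  ∈-allSubsets : ∀ {q} (Y : Subset q) → Y ∈ allSubsets q
  ∈-allSubsets []          = here refl
  ∈-allSubsets (true ∷ Y)  = ∈-++⁺ˡ (∈-map⁺ (true ∷_) (∈-allSubsets Y))
  ∈-allSubsets {suc q} (false ∷ Y) =
    ∈-++⁺ʳ (map (true ∷_) (allSubsets q)) (∈-++⁺ˡ (∈-map⁺ (false ∷_) (∈-allSubsets Y)))

  encode : ∀ {c} → Subset c → Fin (2 ^ c)
  encode Y = index (∈-allSubsets Y)

  encode-injective : ∀ {c} {Y Y' : Subset c} → encode Y ≡ encode Y' → Y ≡ Y'
  encode-injective {Y = Y} {Y'} eq = begin
    Y                                  ≡⟨ lookup-index (∈-allSubsets Y) ⟩
    lookup (allSubsets _) (encode Y)   ≡⟨ cong (lookup (allSubsets _)) eq ⟩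
    lookup (allSubsets _) (encode Y')  ≡⟨ lookup-index (∈-allSubsets Y') ⟨
    Y'                                 ∎

  concat-map-pointwise : ∀ {A : Set} {c n} (f g : A → Vec Bool c) {zs : Vec A n} →
                         concat (map f zs) ≡ concat (map g zs) → ∀ {Y} → Y ∈ zs → f Y ≡ g Y
  concat-map-pointwise f g {z ∷ _} eq (here refl) = proj₁ (++-injective (f z) (g z) eq)
  concat-map-pointwise f g {z ∷ _} eq (there Y∈) = concat-map-pointwise f g (proj₂ (++-injective (f z) (g z) eq)) Y∈

  initialSegment : ∀ {N} → Fin (suc N) → Subset N
  initialSegment k = tabulate (λ p → toℕ p <ᵇ toℕ k)

  chainLetter : ℕ → ℕ → ℕ → Letter 1
  chainLetter p i j with p <ᵇ i | p <ᵇ j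
  ... | true  | _     = 𝟏
  ... | false | true  = var zero
  ... | false | false = 𝟎

  chainLetter-false : ∀ p i j → value (false ∷ []) (chainLetter p i j) ≡ (p <ᵇ i)
  chainLetter-false p i j with p <ᵇ i | p <ᵇ j
  ... | true  | _     = refl
  ... | false | true  = refl
  ... | false | false = refl

  chainLetter-true : ∀ p {i j} → i < j → value (true ∷ []) (chainLetter p i j) ≡ (p <ᵇ j)
  chainLetter-true p {i} {j} i<j with p <ᵇ i | <ᵇ-reflects-< p i | p <ᵇ j | <ᵇ-reflects-< p j
  ... | true  | _       | true  | _       = refl
  ... | true  | ofʸ p<i | false | ofⁿ p≮j = contradiction (<-trans p<i i<j) p≮j
  ... | false | _       | true  | _       = refl
  ... | false | _       | false | _       = refl

  chainLetter-var : ∀ {i j} → i < j → chainLetter i i j ≡ var zero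
  chainLetter-var {i} {j} i<j with i <ᵇ i | <ᵇ-reflects-< i i | i <ᵇ j | <ᵇ-reflects-< i j
  ... | true  | ofʸ i<i | _     | _       = contradiction i<i (<-irrefl refl)
  ... | false | _       | true  | _       = refl
  ... | false | _       | false | ofⁿ i≮j = contradiction i<j i≮j

  chain : ∀ {N} → Fin (suc N) → Fin (suc N) → Word N 1
  chain i j = tabulate (λ p → chainLetter (toℕ p) (toℕ i) (toℕ j))

  inst-tabulate : ∀ {N K} (f : Fin N → Letter K) S → inst (tabulate f) S ≡ tabulate (value S ∘ f)
  inst-tabulate f S = sym (tabulate-∘ (value S) f)

  -- Among the 2^c + 1 initial segments two get the same colour; the chain between them is the line.
  hales-jewett₁ : ∀ c → ∃[ N ] ∀ (κ : Subset N → Vec Bool c) → ∃[ w ] (EveryVarOccurs {N} {1} w × ConstantOn κ w)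
  hales-jewett₁ c = 2 ^ c , λ κ → line κ (pigeonhole ≤-refl (λ k → encode (κ (initialSegment k))))
    where
    line : (κ : Subset (2 ^ c) → Vec Bool c) →
           (∃ λ i → ∃ λ j → i <ᶠ j × encode (κ (initialSegment i)) ≡ encode (κ (initialSegment j))) →
           ∃[ w ] (EveryVarOccurs {2 ^ c} {1} w × ConstantOn κ w)
    line κ (i , j , i<j , same) = chain i j , occurs , constant
      where
      i<N : toℕ i < 2 ^ c
      i<N = <-≤-trans i<j (≤-pred (toℕ<n j))
      occurs : EveryVarOccurs (chain i j)
      occurs zero = fromℕ< i<N , (begin
        lookup (chain i j) (fromℕ< i<N)                         ≡⟨ lookup∘tabulate _ (fromℕ< i<N) ⟩
        chainLetter (toℕ (fromℕ< i<N)) (toℕ i) (toℕ j)         ≡⟨ cong (λ p → chainLetter p (toℕ i) (toℕ j)) (toℕ-fromℕ< i<N) ⟩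
        chainLetter (toℕ i) (toℕ i) (toℕ j)                     ≡⟨ chainLetter-var i<j ⟩
        var zero                                                ∎)
      chain-false : inst (chain i j) (false ∷ []) ≡ initialSegment i
      chain-false = trans (inst-tabulate _ _) (tabulate-cong λ p → chainLetter-false (toℕ p) (toℕ i) (toℕ j))
      chain-true : inst (chain i j) (true ∷ []) ≡ initialSegment j
      chain-true = trans (inst-tabulate _ _) (tabulate-cong λ p → chainLetter-true (toℕ p) i<j)
      constant : ConstantOn κ (chain i j)
      constant (false ∷ []) = refl
      constant (true ∷ [])  = begin
        κ (inst (chain i j) (true ∷ []))   ≡⟨ cong κ chain-true ⟩
        κ (initialSegment j)              ≡⟨ encode-injective same ⟨
        κ (initialSegment i)              ≡⟨ cong κ chain-false ⟨
        κ (inst (chain i j) (false ∷ []))  ∎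

  juxtapose : ∀ {q p K} → Word q 1 → Word p K → Word (q + p) (suc K)
  juxtapose wQ wP = map (rename λ _ → zero) wQ ++ map (rename suc) wP

  inst-juxtapose : ∀ {q p K} (wQ : Word q 1) (wP : Word p K) s S →
                   inst (juxtapose wQ wP) (s ∷ S) ≡ inst wQ (s ∷ []) ++ inst wP S
  inst-juxtapose wQ wP s S =
    trans (map-++ (value (s ∷ S)) (map (rename λ _ → zero) wQ) (map (rename suc) wP))
          (cong₂ _++_ (inst-rename (λ _ → zero) wQ λ { zero → refl }) (inst-rename suc wP λ _ → refl))

  juxtapose-everyVarOccurs : ∀ {q p K} (wQ : Word q 1) (wP : Word p K) →
                             EveryVarOccurs wQ → EveryVarOccurs wP → EveryVarOccurs (juxtapose wQ wP)
  juxtapose-everyVarOccurs {p = p} wQ wP occQ occP zero with occQ zero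
  ... | i , wQi≡var = i ↑ˡ p , (begin
    lookup (juxtapose wQ wP) (i ↑ˡ p)       ≡⟨ lookup-++ˡ (map (rename _) wQ) (map (rename suc) wP) i ⟩
    lookup (map (rename λ _ → zero) wQ) i   ≡⟨ lookup-map i (rename _) wQ ⟩
    rename (λ _ → zero) (lookup wQ i)       ≡⟨ cong (rename _) wQi≡var ⟩
    var zero                                ∎)
  juxtapose-everyVarOccurs {q = q} wQ wP occQ occP (suc t) with occP t
  ... | i , wPi≡var = q ↑ʳ i , (begin
    lookup (juxtapose wQ wP) (q ↑ʳ i)  ≡⟨ lookup-++ʳ (map (rename _) wQ) (map (rename suc) wP) i ⟩
    lookup (map (rename suc) wP) i     ≡⟨ lookup-map i (rename suc) wP ⟩
    rename suc (lookup wP i)           ≡⟨ cong (rename suc) wPi≡var ⟩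
    var (suc t)                        ∎)

  -- Induction on the dimension: colour X ∈ Subset p by the 2^q-tuple of colours of all Y ++ X, take a
  -- subspace wP on which this colouring is constant, and then a line wQ for Y ↦ κ (Y ++ inst wP ∅).
  hales-jewett : ∀ K c → ∃[ N ] ∀ (κ : Subset N → Vec Bool c) → ∃[ w ] (EveryVarOccurs {N} {K} w × ConstantOn κ w)
  hales-jewett zero    c = 0 , λ κ → [] , (λ ()) , λ { [] → refl }
  hales-jewett (suc K) c = q + p , subspace
    where
    q = proj₁ (hales-jewett₁ c)
    p = proj₁ (hales-jewett K (2 ^ q * c))
    subspace : ∀ (κ : Subset (q + p) → Vec Bool c) → ∃[ w ] (EveryVarOccurs {q + p} {suc K} w × ConstantOn κ w)
    subspace κ with proj₂ (hales-jewett K (2 ^ q * c)) (λ X → concat (map (λ Y → κ (Y ++ X)) (allSubsets q)))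
    ... | wP , occP , constP with proj₂ (hales-jewett₁ c) (λ Y → κ (Y ++ inst wP ∅))
    ... | wQ , occQ , constQ = juxtapose wQ wP , juxtapose-everyVarOccurs wQ wP occQ occP , constant
      where
      constant : ConstantOn κ (juxtapose wQ wP)
      constant (s ∷ S) = begin
        κ (inst (juxtapose wQ wP) (s ∷ S))    ≡⟨ cong κ (inst-juxtapose wQ wP s S) ⟩
        κ (inst wQ (s ∷ []) ++ inst wP S)     ≡⟨ concat-map-pointwise (λ Y → κ (Y ++ inst wP S)) (λ Y → κ (Y ++ inst wP ∅))
                                                   (constP S) (∈-allSubsets (inst wQ (s ∷ []))) ⟩
        κ (inst wQ (s ∷ []) ++ inst wP ∅)     ≡⟨ constQ (s ∷ []) ⟩
        κ (inst wQ ∅ ++ inst wP ∅)            ≡⟨ cong κ (inst-juxtapose wQ wP false ∅) ⟨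
        κ (inst (juxtapose wQ wP) ∅)          ∎

module Folkman where

  open import Data.Nat using (zero; suc; _+_; _≤_; s≤s)
  open import Data.Nat.Properties using (≤-trans; ≤-reflexive; n≤1+n; +-suc; m+n≤o⇒n≤o)
  open import Data.Vec using ([]; _∷_; map; replicate)
  import Data.Vec as Vec
  open import Data.Vec.Properties using (lookup-replicate; ∷-injectiveˡ)
  open import Data.Fin using (zero; suc)
  open import Data.Fin.Subset using (Subset; Nonempty) renaming (⊥ to ∅)
  open import Data.Product using (_,_; proj₁; proj₂)
  import Data.Product
  open import Data.Sum using (inj₁; inj₂)
  open import Data.Unit using (⊤)
  open import Relation.Binary.PropositionalEquality
  open import Function using (_∘_; id)
  open ParameterWords
  open HalesJewett

  -- the colour of a nonempty set depends only on its least element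
  MinDetermined : ∀ {m} → (Subset m → Bool) → Set
  MinDetermined {zero}  χ = ⊤
  MinDetermined {suc m} χ = (∀ S → χ (true ∷ S) ≡ χ (true ∷ ∅)) × MinDetermined (χ ∘ (false ∷_))

  MinDetermined-cong : ∀ {m} {χ χ' : Subset m → Bool} → (∀ S → χ S ≡ χ' S) → MinDetermined χ → MinDetermined χ'
  MinDetermined-cong {zero}  _    _               = _
  MinDetermined-cong {suc m} same (constant , rest) =
    (λ S → trans (sym (same (true ∷ S))) (trans (constant S) (same (true ∷ ∅)))) ,
    MinDetermined-cong (same ∘ (false ∷_)) rest

  -- A Hales–Jewett subspace u in 1 + N' variables, with its 𝟏s absorbed into the first variable, has
  -- constant colour on all sets containing that variable; recurse on the other N' variables.
  min-determined-word : ∀ m → ∃[ N ] ∀ (χ : Subset N → Bool) →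
                        ∃[ w ] (EveryVarOccurs {N} {m} w × OneFree w × MinDetermined (χ ∘ inst w))
  min-determined-word zero    = 0 , λ χ → [] , (λ ()) , (λ ()) , _
  min-determined-word (suc m) = proj₁ (hales-jewett (suc N') 1) , word
    where
    N' = proj₁ (min-determined-word m)
    word : ∀ χ → ∃[ w ] (EveryVarOccurs {_} {suc m} w × OneFree w × MinDetermined (χ ∘ inst w))
    word χ with proj₂ (hales-jewett (suc N') 1) (λ X → χ X ∷ [])
    ... | u , occu , constu with proj₂ (min-determined-word m) (χ ∘ inst (map dropVar₀ (map absorbOne u)))
    ... | v , occv , freev , detv =
      compose u' (consVar v) ,
      compose-everyVarOccurs u' (consVar v) (absorbOne-everyVarOccurs u occu) (consVar-everyVarOccurs v occv) ,
      compose-oneFree u' (consVar v) (absorbOne-oneFree u) (consVar-oneFree v freev) ,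
      (λ S → trans (colour-true S) (sym (colour-true ∅))) ,
      MinDetermined-cong (λ S → cong χ (sym (trans (inst-w false S) (inst-false∷ u' (inst v S))))) detv
      where
      u' = map absorbOne u
      inst-w : ∀ s S → inst (compose u' (consVar v)) (s ∷ S) ≡ inst u' (s ∷ inst v S)
      inst-w s S = trans (inst-compose u' (consVar v) (s ∷ S)) (cong (inst u') (inst-consVar v s S))
      colour-true : ∀ S → χ (inst (compose u' (consVar v)) (true ∷ S)) ≡ χ (inst u ∅)
      colour-true S = trans (cong χ (trans (inst-w true S) (inst-absorbOne u (inst v S))))
                            (∷-injectiveˡ (constu (true ∷ inst v S)))

  Homogeneous : ∀ {N} → (Subset N → Bool) → Bool → ℕ → Set
  Homogeneous {N} χ b k = ∃[ w ] (EveryVarOccurs {N} {k} w × OneFree w × (∀ S → Nonempty S → χ (inst w S) ≡ b))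

  homogeneous-zero : ∀ {N} (χ : Subset N → Bool) b → Homogeneous χ b 0
  homogeneous-zero {N} χ b =
    replicate N 𝟎 , (λ ()) , (λ p eq → 𝟎≢𝟏 (trans (sym (lookup-replicate p 𝟎)) eq)) , λ { [] (() , _) }
    where
    𝟎≢𝟏 : 𝟎 ≢ 𝟏 {0}
    𝟎≢𝟏 ()

  homogeneous-skip : ∀ {N k b} (χ : Subset (suc N) → Bool) → Homogeneous (χ ∘ (false ∷_)) b k → Homogeneous χ b k
  homogeneous-skip χ (v , occ , free , hom) =
    𝟎 ∷ v , (λ t → Data.Product.map suc id (occ t)) , (λ { zero () ; (suc p) → free p }) , hom

  homogeneous-extend : ∀ {N k b} (χ : Subset (suc N) → Bool) → (∀ S → χ (true ∷ S) ≡ b) →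
                       Homogeneous (χ ∘ (false ∷_)) b k → Homogeneous χ b (suc k)
  homogeneous-extend χ first (v , occ , free , hom) =
    consVar v , consVar-everyVarOccurs v occ , consVar-oneFree v free , hom'
    where
    hom' : ∀ S → Nonempty S → χ (inst (consVar v) S) ≡ _
    hom' (true ∷ S)  _                       = trans (cong χ (inst-consVar v true S)) (first (inst v S))
    hom' (false ∷ S) (suc x , Vec.there x∈S) = trans (cong χ (inst-consVar v false S)) (hom S (x , x∈S))

  homogeneous-compose : ∀ {N K k b} (χ : Subset N → Bool) (w : Word N K) → EveryVarOccurs w → OneFree w →
                        Homogeneous (χ ∘ inst w) b k → Homogeneous χ b k
  homogeneous-compose χ w occw freew (v , occv , freev , hom) =
    compose w v , compose-everyVarOccurs w v occw occv , compose-oneFree w v freew freev ,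
    λ S S≠∅ → trans (cong χ (inst-compose w v S)) (hom S S≠∅)

  select-homogeneous : ∀ n {χ : Subset n → Bool} → MinDetermined χ →
                       ∀ k₀ k₁ → k₀ + k₁ ≤ suc n → Homogeneous χ false k₀ ⊎ Homogeneous χ true k₁
  select-homogeneous n       {χ} _ zero     k₁       _ = inj₁ (homogeneous-zero χ false)
  select-homogeneous n       {χ} _ (suc k₀) zero     _ = inj₂ (homogeneous-zero χ true)
  select-homogeneous zero        _ (suc k₀) (suc k₁) (s≤s k₀+1+k₁≤0) with m+n≤o⇒n≤o k₀ k₀+1+k₁≤0
  ... | ()
  select-homogeneous (suc n) {χ} (first , rest) (suc k₀) (suc k₁) (s≤s bound) = by-colour (χ (true ∷ ∅)) refl
    where
    by-colour : ∀ b → χ (true ∷ ∅) ≡ b → Homogeneous χ false (suc k₀) ⊎ Homogeneous χ true (suc k₁)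
    by-colour false eq with select-homogeneous n rest k₀ (suc k₁) bound
    ... | inj₁ hom = inj₁ (homogeneous-extend χ (λ S → trans (first S) eq) hom)
    ... | inj₂ hom = inj₂ (homogeneous-skip χ hom)
    by-colour true eq with select-homogeneous n rest (suc k₀) k₁ (≤-trans (≤-reflexive (sym (+-suc k₀ k₁))) bound)
    ... | inj₁ hom = inj₁ (homogeneous-skip χ hom)
    ... | inj₂ hom = inj₂ (homogeneous-extend χ (λ S → trans (first S) eq) hom)

  -- Folkman's theorem: the blocks inst w ⁅ j ⁆ are disjoint and nonempty, and all their nonempty unions get colour b.
  folkman : ∀ m → ∃[ N ] ∀ (χ : Subset N → Bool) → ∃[ b ] Homogeneous χ b m
  folkman m = proj₁ (min-determined-word (m + m)) , homogeneous
    where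
    homogeneous : ∀ χ → ∃[ b ] Homogeneous χ b m
    homogeneous χ with proj₂ (min-determined-word (m + m)) χ
    ... | w , occ , free , det with select-homogeneous (m + m) det m m (n≤1+n (m + m))
    ... | inj₁ hom = false , homogeneous-compose χ w occ free hom
    ... | inj₂ hom = true  , homogeneous-compose χ w occ free hom

module Supports where

  open import Data.Nat using (_≟_)
  open import Data.List using ([]; _∷_; _++_)
  open import Data.List.Properties using (≡-dec)
  open import Data.List.Membership.Propositional using (_∈_)
  open import Data.List.Relation.Unary.Any using (here)
  open import Data.List.Relation.Unary.All using (All; []; _∷_)
  open import Data.List.Relation.Unary.All.Properties using (++⁺)
  import Data.List.Relation.Unary.All as All
  open import Function using (_∘_)
  open import Data.List.Relation.Unary.AllPairs using (_∷_)
  open import Data.Product using (_,_)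
  open import Data.Empty using (⊥; ⊥-elim)
  open import Relation.Nullary using (yes; no; contradiction)
  open import Relation.Binary.PropositionalEquality
  open ≡-Reasoning
  open BooleanGroup

  _≟ᴮ_ : DecidableEquality 𝔹
  _≟ᴮ_ = ≡-dec _≟_

  open Parity _≟ᴮ_ public

  Σᴮ-++ : ∀ xs ys → Σᴮ (xs ++ ys) ≡ Σᴮ xs ⊕ Σᴮ ys
  Σᴮ-++ []       ys = sym (⊕-identityˡ (Σᴮ ys))
  Σᴮ-++ (x ∷ xs) ys = trans (cong (x ⊕_) (Σᴮ-++ xs ys)) (sym (⊕-assoc x (Σᴮ xs) (Σᴮ ys)))

  Σᴮ-toggle : ∀ x l → Σᴮ (toggle x l) ≡ x ⊕ Σᴮ l
  Σᴮ-toggle x []      = refl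
  Σᴮ-toggle x (y ∷ l) with x ≟ᴮ y
  ... | yes refl = sym (⊕-cancelˡ x (Σᴮ l))
  ... | no  _    = trans (cong (y ⊕_) (Σᴮ-toggle x l)) (⊕-swap y x (Σᴮ l))

  Σᴮ-cancelPairs : ∀ l → Σᴮ (cancelPairs l) ≡ Σᴮ l
  Σᴮ-cancelPairs []      = refl
  Σᴮ-cancelPairs (x ∷ l) = trans (Σᴮ-toggle x (cancelPairs l)) (cong (x ⊕_) (Σᴮ-cancelPairs l))

  -- Cancelling pairs leaves a finite subset of X with sum 𝟘 that still contains z.
  linIndep-evenParity : ∀ {X} → LinIndep X → ∀ {z} H → All X H → Σᴮ H ≡ 𝟘 → parity z H ≢ true
  linIndep-evenParity li {z} H H⊆X ΣH≡𝟘 odd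
    with li (cancelPairs H) (cancelPairs-unique H , cancelPairs-All H⊆X) (trans (Σᴮ-cancelPairs H) ΣH≡𝟘)
  ... | reduced≡[] with subst (z ∈_) reduced≡[] (parity-true⇒∈ (cancelPairs H) (trans (parity-cancelPairs z H) odd))
  ... | ()

  concatSupports : ∀ {X : SetB} z ws → All (λ w → ∃[ G ] (All X G × Σᴮ G ≡ w × parity z G ≡ false)) ws →
                   ∃[ H ] (All X H × Σᴮ H ≡ Σᴮ ws × parity z H ≡ false)
  concatSupports z []       []                            = [] , [] , refl , refl
  concatSupports z (w ∷ ws) ((G , G⊆X , ΣG , even) ∷ rest) with concatSupports z ws rest
  ... | H , H⊆X , ΣH , even' =
    G ++ H , ++⁺ G⊆X H⊆X , trans (Σᴮ-++ G H) (cong₂ _⊕_ ΣG ΣH) , trans (parity-++ z G H) (cong₂ _xor_ even even')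

  evenSupport : ∀ {X : SetB} {x w} → FS X w → ¬ InSupp X w x → ∃[ G ] (All X G × Σᴮ G ≡ w × parity x G ≡ false)
  evenSupport (G , (uniqG , G⊆X) , _ , ΣG) x∉w =
    G , G⊆X , ΣG , parity-∉ G λ x∈G → x∉w (G , ((uniqG , G⊆X) , ΣG) , x∈G)

  -- clause (ii) of suitability with y = y'
  private-supportElement : ∀ {X Y : SetB} {y} → Suitable X Y → Y y →
                           ∃[ x ] (InSupp X y x × (∀ w → Y w → w ≢ y → ¬ InSupp X w x))
  private-supportElement {y = y} (inFS , _ , isolated) Yy with inFS y Yy
  ... | [] , _ , G≢[] , _ = contradiction refl G≢[]
  ... | x ∷ G , G⊆X , _ , ΣG with isolated y y Yy Yy (x , (x ∷ G , (G⊆X , ΣG) , here refl) , (x ∷ G , (G⊆X , ΣG) , here refl))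
  ... | x' , x'∈y , _ , x'∉ = x' , x'∈y , λ w Yw w≢y → x'∉ w Yw w≢y w≢y

  -- In a relation y + Σ F = 𝟘 among distinct elements of Y, the private X-support element of y occurs
  -- an odd number of times in the concatenated X-supports.
  suitable⇒linIndep : ∀ {X Y : SetB} → LinIndep X → Suitable X Y → LinIndep Y
  suitable⇒linIndep li suit [] _ _ = refl
  suitable⇒linIndep {X} {Y} li suit@(inFS , _) (y ∷ F) (y∉F ∷ _ , Yy ∷ F⊆Y) Σ≡𝟘 =
    ⊥-elim (odd-relation (private-supportElement suit Yy))
    where
    evenSupports : ∀ {x} → (∀ w → Y w → w ≢ y → ¬ InSupp X w x) →
                   All (λ w → ∃[ G ] (All X G × Σᴮ G ≡ w × parity x G ≡ false)) F
    evenSupports x∉ = All.zipWith (λ { {w} (y≢w , Yw) → evenSupport (inFS w Yw) (x∉ w Yw (y≢w ∘ sym)) }) (y∉F , F⊆Y)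
    odd-relation : ∃[ x ] (InSupp X y x × (∀ w → Y w → w ≢ y → ¬ InSupp X w x)) → ⊥
    odd-relation (x , (G , ((uniqG , G⊆X) , ΣG) , x∈G) , x∉) with concatSupports x F (evenSupports x∉)
    ... | H , H⊆X , ΣH , even = linIndep-evenParity li (G ++ H) (++⁺ G⊆X H⊆X)
      (trans (Σᴮ-++ G H) (trans (cong₂ _⊕_ ΣG ΣH) Σ≡𝟘))
      (trans (parity-++ x G H) (cong₂ _xor_ (parity-∈ G uniqG x∈G) even))

module Blocks where

  open import Data.Nat using (zero; suc)
  open import Data.List using (List; []; _∷_; _++_)
  open import Data.List.Relation.Unary.All using (All; []; _∷_)
  open import Data.List.Relation.Unary.All.Properties using (++⁺)
  open import Data.Vec using (_∷_; []; map; lookup; zipWith)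
  open import Data.Vec.Properties using (lookup-map; lookup-replicate; lookup⇒[]=; []=⇒lookup)
  open import Data.Fin using (zero; suc) renaming (_<_ to _<ᶠ_)
  open import Data.Fin.Properties using (suc-injective; <-cmp; <-irrefl)
  open import Data.Fin.Subset using (Subset; ⁅_⁆) renaming (⊥ to ∅)
  open import Data.Fin.Subset.Properties using (x∈⁅x⁆; x≢y⇒x∉⁅y⁆)
  open import Data.Bool.Properties using (¬-not)
  open import Data.Product using (_,_; proj₁; proj₂)
  open import Relation.Nullary using (contradiction)
  open import Relation.Binary using (tri<; tri≈; tri>)
  open import Relation.Binary.PropositionalEquality
  open import Function using (_∘_)
  open ≡-Reasoning
  open BooleanGroup
  open ParameterWords
  open Supports

  _⊻_ : ∀ {N} → Subset N → Subset N → Subset N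
  _⊻_ = zipWith _xor_

  sumSub-∅ : ∀ {N} (a : Fin N → 𝔹) → sumSub a ∅ ≡ 𝟘
  sumSub-∅ {zero}  a = refl
  sumSub-∅ {suc N} a = sumSub-∅ (a ∘ suc)

  sumSub-⊻ : ∀ {N} (a : Fin N → 𝔹) D D' → sumSub a (D ⊻ D') ≡ sumSub a D ⊕ sumSub a D'
  sumSub-⊻ a []          []           = sym (⊕-identityˡ 𝟘)
  sumSub-⊻ a (true ∷ D)  (true ∷ D')  =
    trans (sumSub-⊻ (a ∘ suc) D D') (sym (⊕-cancel-common (a zero) (sumSub (a ∘ suc) D) (sumSub (a ∘ suc) D')))
  sumSub-⊻ a (true ∷ D)  (false ∷ D') =
    trans (cong (a zero ⊕_) (sumSub-⊻ (a ∘ suc) D D')) (sym (⊕-assoc (a zero) (sumSub (a ∘ suc) D) _))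
  sumSub-⊻ a (false ∷ D) (true ∷ D')  =
    trans (cong (a zero ⊕_) (sumSub-⊻ (a ∘ suc) D D')) (⊕-swap (a zero) (sumSub (a ∘ suc) D) _)
  sumSub-⊻ a (false ∷ D) (false ∷ D') = sumSub-⊻ (a ∘ suc) D D'

  sumSub-cong : ∀ {N} {a b : Fin N → 𝔹} → (∀ j → a j ≡ b j) → ∀ S → sumSub a S ≡ sumSub b S
  sumSub-cong same []          = refl
  sumSub-cong same (true ∷ S)  = cong₂ _⊕_ (same zero) (sumSub-cong (same ∘ suc) S)
  sumSub-cong same (false ∷ S) = sumSub-cong (same ∘ suc) S

  inst-true∷ : ∀ {N K} (w : Word N (suc K)) → OneFree w → ∀ S →
               inst w (true ∷ S) ≡ inst w (true ∷ ∅) ⊻ inst (map dropVar₀ w) S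
  inst-true∷ []      _    S = refl
  inst-true∷ (l ∷ w) free S = cong₂ _∷_ (value-true∷ l (free zero)) (inst-true∷ w (free ∘ suc) S)
    where
    value-true∷ : ∀ l → l ≢ 𝟏 → value (true ∷ S) l ≡ value (true ∷ ∅) l xor value S (dropVar₀ l)
    value-true∷ 𝟎             _   = refl
    value-true∷ 𝟏             l≢𝟏 = contradiction refl l≢𝟏
    value-true∷ (var zero)    _   = refl
    value-true∷ (var (suc t)) _   = cong (_xor lookup S t) (sym (lookup-replicate t false))

  inst-noVars : ∀ {N} (w : Word N 0) → OneFree w → inst w [] ≡ ∅
  inst-noVars []      _    = refl
  inst-noVars (𝟎 ∷ w) free = cong (false ∷_) (inst-noVars w (free ∘ suc))
  inst-noVars (𝟏 ∷ w) free = contradiction refl (free zero)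

  dropVar₀-oneFree : ∀ {N K} (w : Word N (suc K)) → OneFree w → OneFree (map dropVar₀ w)
  dropVar₀-oneFree w free p eq = dropVar₀-≢𝟏 (lookup w p) (free p) (trans (sym (lookup-map p dropVar₀ w)) eq)
    where
    dropVar₀-≢𝟏 : ∀ {K} (l : Letter (suc K)) → l ≢ 𝟏 → dropVar₀ l ≢ 𝟏
    dropVar₀-≢𝟏 𝟎             _   ()
    dropVar₀-≢𝟏 𝟏             l≢𝟏 _ = l≢𝟏 refl
    dropVar₀-≢𝟏 (var zero)    _   ()
    dropVar₀-≢𝟏 (var (suc t)) _   ()

  -- The blocks inst w ⁅ j ⁆ of a one-free word are disjoint, with union inst w S over j ∈ S.
  sumSub-blocks : ∀ {N m} (a : Fin N → 𝔹) (w : Word N m) → OneFree w → ∀ S →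
                  sumSub (λ j → sumSub a (inst w ⁅ j ⁆)) S ≡ sumSub a (inst w S)
  sumSub-blocks {m = zero}  a w free [] = sym (trans (cong (sumSub a) (inst-noVars w free)) (sumSub-∅ a))
  sumSub-blocks {m = suc m} a w free (s ∷ S) = by-first s
    where
    w⁻ = map dropVar₀ w
    rest : sumSub (λ j → sumSub a (inst w ⁅ suc j ⁆)) S ≡ sumSub a (inst w⁻ S)
    rest = trans (sumSub-cong (λ j → cong (sumSub a) (inst-false∷ w ⁅ j ⁆)) S)
                 (sumSub-blocks a w⁻ (dropVar₀-oneFree w free) S)
    by-first : ∀ s → sumSub (λ j → sumSub a (inst w ⁅ j ⁆)) (s ∷ S) ≡ sumSub a (inst w (s ∷ S))
    by-first false = trans rest (sym (cong (sumSub a) (inst-false∷ w S)))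
    by-first true  = begin
      sumSub a (inst w (true ∷ ∅)) ⊕ sumSub (λ j → sumSub a (inst w ⁅ suc j ⁆)) S
        ≡⟨ cong (sumSub a (inst w (true ∷ ∅)) ⊕_) rest ⟩
      sumSub a (inst w (true ∷ ∅)) ⊕ sumSub a (inst w⁻ S)
        ≡⟨ sumSub-⊻ a (inst w (true ∷ ∅)) (inst w⁻ S) ⟨
      sumSub a (inst w (true ∷ ∅) ⊻ inst w⁻ S)
        ≡⟨ cong (sumSub a) (inst-true∷ w free S) ⟨
      sumSub a (inst w (true ∷ S))
        ∎

  concatOver : ∀ {N} → (Fin N → List 𝔹) → Subset N → List 𝔹
  concatOver F []          = []
  concatOver F (true ∷ D)  = F zero ++ concatOver (F ∘ suc) D
  concatOver F (false ∷ D) = concatOver (F ∘ suc) D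

  concatOver-All : ∀ {N} {P : 𝔹 → Set} {F : Fin N → List 𝔹} → (∀ s → All P (F s)) → ∀ D → All P (concatOver F D)
  concatOver-All all []          = []
  concatOver-All all (true ∷ D)  = ++⁺ (all zero) (concatOver-All (all ∘ suc) D)
  concatOver-All all (false ∷ D) = concatOver-All (all ∘ suc) D

  Σᴮ-concatOver : ∀ {N} {F : Fin N → List 𝔹} {a : Fin N → 𝔹} → (∀ s → Σᴮ (F s) ≡ a s) →
                  ∀ D → Σᴮ (concatOver F D) ≡ sumSub a D
  Σᴮ-concatOver         sums []          = refl
  Σᴮ-concatOver {F = F} sums (true ∷ D)  =
    trans (Σᴮ-++ (F zero) _) (cong₂ _⊕_ (sums zero) (Σᴮ-concatOver (sums ∘ suc) D))
  Σᴮ-concatOver         sums (false ∷ D) = Σᴮ-concatOver (sums ∘ suc) D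

  parity-concatOver-even : ∀ {N} z (F : Fin N → List 𝔹) → (∀ s → parity z (F s) ≡ false) →
                           ∀ D → parity z (concatOver F D) ≡ false
  parity-concatOver-even z F even []          = refl
  parity-concatOver-even z F even (true ∷ D)  =
    trans (parity-++ z (F zero) _) (cong₂ _xor_ (even zero) (parity-concatOver-even z (F ∘ suc) (even ∘ suc) D))
  parity-concatOver-even z F even (false ∷ D) = parity-concatOver-even z (F ∘ suc) (even ∘ suc) D

  parity-concatOver : ∀ {N} z (F : Fin N → List 𝔹) t → (∀ s → s ≢ t → parity z (F s) ≡ false) →
                      parity z (F t) ≡ true → ∀ D → parity z (concatOver F D) ≡ lookup D t
  parity-concatOver z F zero    even odd (true ∷ D)  =
    trans (parity-++ z (F zero) _) (cong₂ _xor_ odd (parity-concatOver-even z (F ∘ suc) (λ s → even (suc s) λ ()) D))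
  parity-concatOver z F zero    even odd (false ∷ D) = parity-concatOver-even z (F ∘ suc) (λ s → even (suc s) λ ()) D
  parity-concatOver z F (suc t) even odd (true ∷ D)  =
    trans (parity-++ z (F zero) _) (cong₂ _xor_ (even zero λ ()) (parity-concatOver z (F ∘ suc) t even' odd D))
    where even' = λ s s≢t → even (suc s) (s≢t ∘ suc-injective)
  parity-concatOver z F (suc t) even odd (false ∷ D) =
    parity-concatOver z (F ∘ suc) t (λ s s≢t → even (suc s) (s≢t ∘ suc-injective)) odd D

  lookup-⁅⁆-self : ∀ {m} (j : Fin m) → lookup ⁅ j ⁆ j ≡ true
  lookup-⁅⁆-self j = []=⇒lookup (x∈⁅x⁆ j)

  lookup-⁅⁆-other : ∀ {m} {j k : Fin m} → j ≢ k → lookup ⁅ k ⁆ j ≡ false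
  lookup-⁅⁆-other {j = j} {k} j≢k = ¬-not λ eq → x≢y⇒x∉⁅y⁆ j≢k (lookup⇒[]= j ⁅ k ⁆ eq)

  SupportWitness : SetB → SetB → ∀ m → (Fin m → 𝔹) → Set
  SupportWitness X Y m a =
    ∃[ y ] (IsWitness X Y m y × (∀ j → InSupp Y (a j) (y j)) × (∀ j k → j ≢ k → ¬ InSupp Y (a k) (y j)))

  supportWitness-blocks : ∀ {X Y : SetB} {N m} → LinIndep X → Suitable X Y → (a : Fin N → 𝔹) →
                          SupportWitness X Y N a → (w : Word N m) → EveryVarOccurs w → OneFree w →
                          SupportWitness X Y m (λ j → sumSub a (inst w ⁅ j ⁆))
  supportWitness-blocks {X} {Y} {N} {m} li suit a (y , (Yy , meet) , y∈a , y∉a) w occ free =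
    y ∘ t , (Yy ∘ t , meet-blocks) , y∈block , y∉block
    where
    t : Fin m → Fin N
    t j = proj₁ (occ j)
    F : Fin N → List 𝔹
    F s = proj₁ (y∈a s)
    F-supp : ∀ s → IsSupp Y (a s) (F s)
    F-supp s = proj₁ (proj₂ (y∈a s))
    blockList : Fin m → List 𝔹
    blockList k = concatOver F (inst w ⁅ k ⁆)
    blockList-All : ∀ k → All Y (blockList k)
    blockList-All k = concatOver-All (proj₂ ∘ proj₁ ∘ F-supp) (inst w ⁅ k ⁆)
    Σᴮ-blockList : ∀ k → Σᴮ (blockList k) ≡ sumSub a (inst w ⁅ k ⁆)
    Σᴮ-blockList k = Σᴮ-concatOver (proj₂ ∘ F-supp) (inst w ⁅ k ⁆)
    parity-blockList : ∀ j k → parity (y (t j)) (blockList k) ≡ lookup ⁅ k ⁆ j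
    parity-blockList j k = begin
      parity (y (t j)) (blockList k)        ≡⟨ parity-concatOver (y (t j)) F (t j) even odd (inst w ⁅ k ⁆) ⟩
      lookup (inst w ⁅ k ⁆) (t j)          ≡⟨ lookup-map (t j) (value ⁅ k ⁆) w ⟩
      value ⁅ k ⁆ (lookup w (t j))         ≡⟨ cong (value ⁅ k ⁆) (proj₂ (occ j)) ⟩
      lookup ⁅ k ⁆ j                        ∎
      where
      even : ∀ s → s ≢ t j → parity (y (t j)) (F s) ≡ false
      even s s≢tj = parity-∉ (F s) λ yt∈Fs → y∉a (t j) s (s≢tj ∘ sym) (F s , F-supp s , yt∈Fs)
      odd : parity (y (t j)) (F (t j)) ≡ true
      odd = parity-∈ (F (t j)) (proj₁ (proj₁ (F-supp (t j)))) (proj₂ (proj₂ (y∈a (t j))))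
    y∈block : ∀ j → InSupp Y (sumSub a (inst w ⁅ j ⁆)) (y (t j))
    y∈block j =
      cancelPairs (blockList j) ,
      ((cancelPairs-unique (blockList j) , cancelPairs-All (blockList-All j)) ,
        trans (Σᴮ-cancelPairs (blockList j)) (Σᴮ-blockList j)) ,
      parity-true⇒∈ (cancelPairs (blockList j))
        (trans (parity-cancelPairs _ (blockList j)) (trans (parity-blockList j j) (lookup-⁅⁆-self j)))
    y∉block : ∀ j k → j ≢ k → ¬ InSupp Y (sumSub a (inst w ⁅ k ⁆)) (y (t j))
    y∉block j k j≢k (G , ((uniqG , G⊆Y) , ΣG) , y∈G) =
      linIndep-evenParity (suitable⇒linIndep li suit) (G ++ blockList k) (++⁺ G⊆Y (blockList-All k))
        (trans (Σᴮ-++ G (blockList k)) (trans (cong₂ _⊕_ ΣG (Σᴮ-blockList k)) (⊕-self (sumSub a (inst w ⁅ k ⁆)))))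
        (trans (parity-++ _ G (blockList k))
               (cong₂ _xor_ (parity-∈ G uniqG y∈G) (trans (parity-blockList j k) (lookup-⁅⁆-other j≢k))))
    var-injective : ∀ {j k : Fin m} → var {m} j ≡ var k → j ≡ k
    var-injective refl = refl
    meet-blocks : ∀ j k → j <ᶠ k → SuppMeet X (y (t j)) (y (t k))
    meet-blocks j k j<k with <-cmp (t j) (t k)
    ... | tri< tj<tk _ _ = meet (t j) (t k) tj<tk
    ... | tri≈ _ tj≡tk _ =
      contradiction (var-injective (trans (sym (proj₂ (occ j))) (trans (cong (lookup w) tj≡tk) (proj₂ (occ k)))))
                    (λ j≡k → <-irrefl j≡k j<k)
    ... | tri> _ _ tk<tj with meet (t k) (t j) tk<tj
    ... | x , x∈k , x∈j = x , x∈j , x∈k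

open import Data.Nat using (zero; suc)
open import Data.Bool using (Bool; true; false)
open import Data.Fin using (zero)
open import Data.Fin.Subset using (Subset; Nonempty; ⁅_⁆)
open import Data.Fin.Subset.Properties using (nonempty?)
open import Data.Product using (_,_; proj₁; proj₂)
open import Data.Sum using (inj₁; inj₂)
open import Relation.Nullary using (yes; no; contradiction)
open import Relation.Binary.PropositionalEquality using (subst; sym)
open import Function using (_∘_)
open ParameterWords using (Word; inst; EveryVarOccurs; OneFree; inst-nonempty)
open Folkman using (folkman)
open Blocks using (SupportWitness; sumSub-blocks; supportWitness-blocks)

Cell : SetB → SetB → Bool → SetB
Cell C₀ C₁ true  = C₀
Cell C₀ C₁ false = C₁

cellOf : ∀ {P Q : Set} → P ⊎ Q → Bool
cellOf (inj₁ _) = true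
cellOf (inj₂ _) = false

cellOf-correct : ∀ {C₀ C₁ : SetB} {x} (c : C₀ x ⊎ C₁ x) → Cell C₀ C₁ (cellOf c) x
cellOf-correct (inj₁ c) = c
cellOf-correct (inj₂ c) = c

-- the empty set, whose sum need not lie in A, gets an arbitrary colour
cellColouring : ∀ {N} {A C₀ C₁ : SetB} → (∀ x → A x → C₀ x ⊎ C₁ x) → (a : Fin N → 𝔹) →
                (∀ D → Nonempty D → A (sumSub a D)) → Subset N → Bool
cellColouring split a inA D with nonempty? D
... | yes D≠∅ = cellOf (split _ (inA D D≠∅))
... | no  _   = true

cellColouring-correct : ∀ {N} {A C₀ C₁ : SetB} (split : ∀ x → A x → C₀ x ⊎ C₁ x) (a : Fin N → 𝔹)
                        (inA : ∀ D → Nonempty D → A (sumSub a D)) →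
                        ∀ D → Nonempty D → Cell C₀ C₁ (cellColouring split a inA D) (sumSub a D)
cellColouring-correct {C₀ = C₀} {C₁} split a inA D D≠∅ with nonempty? D
... | yes D≠∅' = cellOf-correct {C₀ = C₀} {C₁} (split _ (inA D D≠∅'))
... | no  D≡∅  = contradiction D≠∅ D≡∅

blocks-adequate : ∀ {n N m} {Xs Ys : Fin n → SetB} {C : SetB} →
                  (∀ i → LinIndep (Xs i)) → (∀ i → Suitable (Xs i) (Ys i)) → (a : Fin N → 𝔹) →
                  (∀ i S → Nonempty S → FS (Ys i) (sumSub a S)) → (∀ i → SupportWitness (Xs i) (Ys i) N a) →
                  (w : Word N m) → EveryVarOccurs w → OneFree w → (∀ S → Nonempty S → C (sumSub a (inst w S))) →
                  Adequate n Xs Ys C m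
blocks-adequate {Ys = Ys} {C} lin suit a inFS witness w occ free inC =
  (λ j → sumSub a (inst w ⁅ j ⁆)) , λ i →
    (λ S S≠∅ → subst C (sym (sumSub-blocks a w free S)) (inC S S≠∅) ,
               subst (FS (Ys i)) (sym (sumSub-blocks a w free S)) (inFS i (inst w S) (inst-nonempty w occ S S≠∅))) ,
    supportWitness-blocks (lin i) (suit i) a (witness i) w occ free

mainTheorem13 : ∀ (m : ℕ) → ∃[ M ]
    (∀ (n : ℕ) (Xs Ys : Fin n → SetB) →
      (∀ i → LinIndep (Xs i)) → (∀ i → Suitable (Xs i) (Ys i)) →
      ∀ (A C₀ C₁ : SetB) →
      (∀ b → C₀ b → A b) → (∀ b → C₁ b → A b) →
      (∀ b → A b → C₀ b ⊎ C₁ b) → (∀ b → C₀ b → ¬ C₁ b) →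
      Adequate n Xs Ys A M →
      Adequate n Xs Ys C₀ m ⊎ Adequate n Xs Ys C₁ m)
mainTheorem13 m = M , regular
  where
  M = proj₁ (folkman m)
  regular : ∀ (n : ℕ) (Xs Ys : Fin n → SetB) →
    (∀ i → LinIndep (Xs i)) → (∀ i → Suitable (Xs i) (Ys i)) →
    ∀ (A C₀ C₁ : SetB) →
    (∀ b → C₀ b → A b) → (∀ b → C₁ b → A b) →
    (∀ b → A b → C₀ b ⊎ C₁ b) → (∀ b → C₀ b → ¬ C₁ b) →
    Adequate n Xs Ys A M →
    Adequate n Xs Ys C₀ m ⊎ Adequate n Xs Ys C₁ m
  -- adequacy yields FS(a) ⊆ A only through some pair, here pair 0; with no pairs there is nothing to show
  regular zero    _  _  _   _    _ _  _  _ _ _     _ _ = inj₁ ((λ _ → 𝟘) , λ ())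
  regular (suc n) Xs Ys lin suit A C₀ C₁ _ _ split _ (a , adequateA)
    with proj₂ (folkman m) (cellColouring split a λ D D≠∅ → proj₁ (proj₁ (adequateA zero) D D≠∅))
  ... | b , w , occ , free , hom = inCell b (blocks-adequate {C = Cell C₀ C₁ b} lin suit a
          (λ i S S≠∅ → proj₂ (proj₁ (adequateA i) S S≠∅)) (proj₂ ∘ adequateA) w occ free
          (λ S S≠∅ → subst (λ c → Cell C₀ C₁ c (sumSub a (inst w S))) (hom S S≠∅)
                           (cellColouring-correct split a _ (inst w S) (inst-nonempty w occ S S≠∅))))
    where
    inCell : ∀ b → Adequate (suc n) Xs Ys (Cell C₀ C₁ b) m → Adequate (suc n) Xs Ys C₀ m ⊎ Adequate (suc n) Xs Ys C₁ m
    inCell true  = inj₁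
    inCell false = inj₂
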